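{- Let $N,r,n$ be positive integers. Then $$ c_{N,n}^{(r)}=n!\sum_{k=1}^n(-1)^{n-k}\sum_{\substack{e_1+\cdots+e_k=n\\ e_1,\dots,e_k\ge 1}}D_r(e_1)\cdots D_r(e_k), $$ where for integers $e\ge 0$, $$ D_r(e)=\sum_{\substack{i_1+\cdots+i_r=e\\ i_1,\dots,i_r\ge 0}}\frac{N^r}{(N+i_1)\cdots(N+i_r)}. $$
   Context: For positive integers $N$ and $r$, the (multiple) hypergeometric Cauchy numbers $c_{N,n}^{(r)}$ ($n\ge0$) are defined by the formal power series identity $$\frac{1}{\bigl({}_2F_1(1,N;N+1;-x)\bigr)^r}=\left(\frac{(-1)^{N-1}x^N/N}{\log(1+x)-\sum_{k=1}^{N-1}(-1)^{k-1}x^k/k}\right)^r=\sum_{n=0}^\infty c_{N,n}^{(r)}\frac{x^n}{n!},$$ where ${}_2F_1(a,b;c;z)=\sum_{n\ge0}\frac{(a)^{(n)}(b)^{(n)}}{(c)^{(n)}}\frac{z^n}{n!}$ is the Gauss hypergeometric function and $(x)^{(n)}=x(x+1)\cdots(x+n-1)$, $(x)^{(0)}=1$. -}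

module Defs where

open import Data.Nat as ℕ using (ℕ; zero; suc; _∸_; _≤?_)
open import Data.Nat.Combinatorics using ()
open import Data.Integer as ℤ using (+_)
open import Data.Rational as ℚ using (ℚ; 0ℚ; 1ℚ; _+_; _*_; -_; _/_)
open import Data.List using (List; []; _∷_; map; foldr; concatMap; upTo)
open import Relation.Nullary using (yes; no)

ℕ→ℚ : ℕ → ℚ
ℕ→ℚ n = + n / 1

-- reciprocal of a natural number (only ever applied to positive ones;
-- the value at 0 is an irrelevant convention)
recipℕ : ℕ → ℚ
recipℕ zero    = 0ℚ
recipℕ (suc k) = + 1 / suc k

_^ℚ_ : ℚ → ℕ → ℚ
x ^ℚ zero  = 1ℚ
x ^ℚ suc n = x * (x ^ℚ n)

sumℚ : List ℚ → ℚ
sumℚ = foldr _+_ 0ℚ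

prodℚ : List ℚ → ℚ
prodℚ = foldr _*_ 1ℚ

fact : ℕ → ℕ
fact zero    = 1
fact (suc n) = suc n ℕ.* fact n

rising : ℕ → ℕ → ℕ
rising x zero    = 1
rising x (suc n) = rising x n ℕ.* (x ℕ.+ n)

-- Formal power series over ℚ: a series is its coefficient sequence
-- (coefficient of x^n, ordinary, not exponential).

Series : Set
Series = ℕ → ℚ

oneS : Series
oneS zero    = 1ℚ
oneS (suc _) = 0ℚ

_⊛_ : Series → Series → Series
(a ⊛ b) n = sumℚ (map (λ k → a k * b (n ∸ k)) (upTo (suc n)))

powS : Series → ℕ → Series
powS a zero    = oneS
powS a (suc r) = a ⊛ powS a r

-- Reciprocal of a series a with constant term a_0 = 1:
-- b_0 = 1,  b_m = - Σ_{k=1}^{m} a_k b_{m-k}  (m ≥ 1), i.e. a ⊛ b = 1.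
-- invUpTo a n is a sequence agreeing with b at all indices ≤ n.
invUpTo : Series → ℕ → Series
invUpTo a zero    m = 1ℚ
invUpTo a (suc n) m with m ≤? n
... | yes _ = invUpTo a n m
... | no  _ = - sumℚ (map (λ k → a (suc k) * invUpTo a n (n ∸ k)) (upTo (suc n)))

invS : Series → Series
invS a n = invUpTo a n n

hyp2F1coeff : ℕ → ℕ → ℕ → ℕ → ℚ
hyp2F1coeff a b c n =
  ℕ→ℚ (rising a n ℕ.* rising b n) * recipℕ (rising c n ℕ.* fact n)

-- the series x ↦ 2F1(1,N;N+1;-x)
F : ℕ → Series
F N n = ((- 1ℚ) ^ℚ n) * hyp2F1coeff 1 N (suc N) n

-- hypergeometric Cauchy numbers:
-- 1 / (2F1(1,N;N+1;-x))^r = Σ_n c_{N,n}^{(r)} x^n / n!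
hcauchy : ℕ → ℕ → ℕ → ℚ
hcauchy N r n = ℕ→ℚ (fact n) * invS (powS (F N) r) n

weakComps : ℕ → ℕ → List (List ℕ)
weakComps zero    zero    = [] ∷ []
weakComps zero    (suc _) = []
weakComps (suc k) n =
  concatMap (λ i → map (i ∷_) (weakComps k (n ∸ i))) (upTo (suc n))

comps : ℕ → ℕ → List (List ℕ)
comps zero    zero    = [] ∷ []
comps zero    (suc _) = []
comps (suc k) n =
  concatMap (λ i → map (suc i ∷_) (comps k (n ∸ suc i))) (upTo n)

D : ℕ → ℕ → ℕ → ℚ
D N r e = sumℚ (map (λ is → ℕ→ℚ (N ℕ.^ r) * recipℕ (foldr ℕ._*_ 1 (map (N ℕ.+_) is)))
                    (weakComps r e))

rhs : ℕ → ℕ → ℕ → ℚ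
rhs N r n = ℕ→ℚ (fact n) *
  sumℚ (map (λ j → ((- 1ℚ) ^ℚ (n ∸ suc j)) *
                   sumℚ (map (λ es → prodℚ (map (D N r) es)) (comps (suc j) n)))
            (upTo n))

-- The coefficient of x^e in 2F1(1,N;N+1;-x) is (-1)^e N/(N+e), and D_r is the
-- r-fold convolution power of e ↦ N/(N+e); so the e-th coefficient of the r-th
-- power a of that series is (-1)^e D_r(e).  Expanding 1/a = 1/(1 - (1 - a))
-- geometrically, its m-th coefficient is the sum over k and over compositions
-- (e_1,…,e_k) of m of (-a_{e_1})⋯(-a_{e_k}); as -a_e = (-1)^(e+1) D_r(e), each
-- such product carries the sign (-1)^(m+k) = (-1)^(m-k).

module Submission where

open import Defs
open import Data.Nat as ℕ using (ℕ; zero; suc; _∸_; _≤_; _<_; z≤n; s≤s; _≤?_; NonZero)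
import Data.Nat.Properties as ℕP
open import Data.Integer as ℤ using (+_)
import Data.Integer.Properties as ℤP
open import Data.Rational as ℚ using (ℚ; 0ℚ; 1ℚ; _+_; _*_; -_)
import Data.Rational.Properties as ℚP
import Data.Rational.Unnormalised as ℚᵘ
import Data.Rational.Unnormalised.Properties as ℚᵘP
open import Data.Rational.Solver using (module +-*-Solver)
open import Data.List using (List; []; _∷_; map; foldr; concatMap; upTo; applyUpTo; _++_)
open import Data.List.Properties using (map-applyUpTo; map-++; map-cong)
open import Data.Empty using (⊥-elim)
open import Function using (id; _∘_)
open import Relation.Nullary using (yes; no)
open import Relation.Binary.PropositionalEquality

open +-*-Solver

*-interchange : ∀ a b c d → (a * b) * (c * d) ≡ (a * c) * (b * d)
*-interchange = solve 4 (λ a b c d → (a :* b) :* (c :* d) := (a :* c) :* (b :* d)) refl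

+-interchange : ∀ a b c d → (a + b) + (c + d) ≡ (a + c) + (b + d)
+-interchange = solve 4 (λ a b c d → (a :+ b) :+ (c :+ d) := (a :+ c) :+ (b :+ d)) refl

fromℚᵘ-homo-* : ∀ p q → ℚ.fromℚᵘ (p ℚᵘ.* q) ≡ ℚ.fromℚᵘ p * ℚ.fromℚᵘ q
fromℚᵘ-homo-* p q = ℚP.toℚᵘ-injective (begin-equality
  ℚ.toℚᵘ (ℚ.fromℚᵘ (p ℚᵘ.* q))                ≃⟨ ℚP.toℚᵘ-fromℚᵘ (p ℚᵘ.* q) ⟩
  p ℚᵘ.* q                                      ≃⟨ ℚᵘP.*-cong (ℚᵘP.≃-sym (ℚP.toℚᵘ-fromℚᵘ p)) (ℚᵘP.≃-sym (ℚP.toℚᵘ-fromℚᵘ q)) ⟩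
  ℚ.toℚᵘ (ℚ.fromℚᵘ p) ℚᵘ.* ℚ.toℚᵘ (ℚ.fromℚᵘ q) ≃⟨ ℚᵘP.≃-sym (ℚP.toℚᵘ-homo-* (ℚ.fromℚᵘ p) (ℚ.fromℚᵘ q)) ⟩
  ℚ.toℚᵘ (ℚ.fromℚᵘ p * ℚ.fromℚᵘ q)            ∎)
  where open ℚᵘP.≤-Reasoning

ℕ→ℚ-homo-* : ∀ a b → ℕ→ℚ (a ℕ.* b) ≡ ℕ→ℚ a * ℕ→ℚ b
ℕ→ℚ-homo-* a b = trans
  (ℚP.fromℚᵘ-cong {ℚᵘ.mkℚᵘ (+ (a ℕ.* b)) 0} {ℚᵘ.mkℚᵘ (+ a) 0 ℚᵘ.* ℚᵘ.mkℚᵘ (+ b) 0}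
                  (ℚᵘ.*≡* (cong (ℤ._* + 1) (ℤP.pos-* a b))))
  (fromℚᵘ-homo-* (ℚᵘ.mkℚᵘ (+ a) 0) (ℚᵘ.mkℚᵘ (+ b) 0))

recipℕ-homo-* : ∀ a b → recipℕ (a ℕ.* b) ≡ recipℕ a * recipℕ b
recipℕ-homo-* zero    b       = sym (ℚP.*-zeroˡ (recipℕ b))
recipℕ-homo-* (suc a) zero    rewrite ℕP.*-zeroʳ a = sym (ℚP.*-zeroʳ (recipℕ (suc a)))
recipℕ-homo-* (suc a) (suc b) = fromℚᵘ-homo-* (ℚᵘ.mkℚᵘ (+ 1) a) (ℚᵘ.mkℚᵘ (+ 1) b)

ℕ→ℚ*recipℕ≡1 : ∀ d .{{_ : NonZero d}} → ℕ→ℚ d * recipℕ d ≡ 1ℚ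
ℕ→ℚ*recipℕ≡1 (suc d) = trans (sym (fromℚᵘ-homo-* (ℚᵘ.mkℚᵘ (+ suc d) 0) (ℚᵘ.mkℚᵘ (+ 1) d)))
  (ℚP.fromℚᵘ-cong {ℚᵘ.mkℚᵘ (+ suc d) 0 ℚᵘ.* ℚᵘ.mkℚᵘ (+ 1) d} {ℚᵘ.mkℚᵘ (+ 1) 0} (ℚᵘ.*≡* (begin
    (+ suc d ℤ.* + 1) ℤ.* + 1 ≡⟨ cong (ℤ._* + 1) (ℤP.*-identityʳ (+ suc d)) ⟩
    + suc d ℤ.* + 1           ≡⟨ ℤP.*-identityʳ (+ suc d) ⟩
    + suc d                   ≡⟨ cong +_ (sym (ℕP.*-identityˡ (suc d))) ⟩
    + (1 ℕ.* suc d)           ≡⟨ sym (ℤP.*-identityˡ (+ (1 ℕ.* suc d))) ⟩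
    + 1 ℤ.* + (1 ℕ.* suc d)   ∎)))
  where open ≡-Reasoning

ℕ→ℚ*recipℕ-cross : ∀ a b c d .{{_ : NonZero b}} .{{_ : NonZero d}} →
  a ℕ.* d ≡ c ℕ.* b → ℕ→ℚ a * recipℕ b ≡ ℕ→ℚ c * recipℕ d
ℕ→ℚ*recipℕ-cross a b c d ad≡cb = begin
  ℕ→ℚ a * recipℕ b                           ≡⟨ sym (ℚP.*-identityʳ _) ⟩
  ℕ→ℚ a * recipℕ b * 1ℚ                      ≡⟨ cong (ℕ→ℚ a * recipℕ b *_) (sym (ℕ→ℚ*recipℕ≡1 d)) ⟩
  ℕ→ℚ a * recipℕ b * (ℕ→ℚ d * recipℕ d)     ≡⟨ *-interchange (ℕ→ℚ a) (recipℕ b) (ℕ→ℚ d) (recipℕ d) ⟩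
  ℕ→ℚ a * ℕ→ℚ d * (recipℕ b * recipℕ d)     ≡⟨ cong₂ _*_ (sym (ℕ→ℚ-homo-* a d)) (sym (recipℕ-homo-* b d)) ⟩
  ℕ→ℚ (a ℕ.* d) * recipℕ (b ℕ.* d)           ≡⟨ cong₂ (λ x y → ℕ→ℚ x * recipℕ y) ad≡cb (ℕP.*-comm b d) ⟩
  ℕ→ℚ (c ℕ.* b) * recipℕ (d ℕ.* b)           ≡⟨ cong₂ _*_ (ℕ→ℚ-homo-* c b) (recipℕ-homo-* d b) ⟩
  ℕ→ℚ c * ℕ→ℚ b * (recipℕ d * recipℕ b)     ≡⟨ *-interchange (ℕ→ℚ c) (ℕ→ℚ b) (recipℕ d) (recipℕ b) ⟩
  ℕ→ℚ c * recipℕ d * (ℕ→ℚ b * recipℕ b)     ≡⟨ cong (ℕ→ℚ c * recipℕ d *_) (ℕ→ℚ*recipℕ≡1 b) ⟩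
  ℕ→ℚ c * recipℕ d * 1ℚ                      ≡⟨ ℚP.*-identityʳ _ ⟩
  ℕ→ℚ c * recipℕ d                           ∎
  where open ≡-Reasoning

∑< : ℕ → (ℕ → ℚ) → ℚ
∑< n f = sumℚ (applyUpTo f n)

syntax ∑< n (λ i → e) = ∑[ i < n ] e

∑<-upTo : ∀ n f → sumℚ (map f (upTo n)) ≡ ∑< n f
∑<-upTo n f = cong sumℚ (map-applyUpTo id f n)

∑<-cong : ∀ n {f g} → (∀ i → i < n → f i ≡ g i) → ∑< n f ≡ ∑< n g
∑<-cong zero    f≡g = refl
∑<-cong (suc n) f≡g = cong₂ _+_ (f≡g 0 (s≤s z≤n)) (∑<-cong n (λ i i<n → f≡g (suc i) (s≤s i<n)))

∑<-zero : ∀ n → ∑[ i < n ] 0ℚ ≡ 0ℚ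
∑<-zero zero    = refl
∑<-zero (suc n) = trans (ℚP.+-identityˡ _) (∑<-zero n)

∑<-distrib-+ : ∀ n f g → ∑[ i < n ] (f i + g i) ≡ ∑< n f + ∑< n g
∑<-distrib-+ zero    f g = refl
∑<-distrib-+ (suc n) f g = trans (cong (_+_ (f 0 + g 0)) (∑<-distrib-+ n (f ∘ suc) (g ∘ suc)))
                                 (+-interchange (f 0) (g 0) (∑< n (f ∘ suc)) (∑< n (g ∘ suc)))

*-distribˡ-∑< : ∀ n c f → ∑[ i < n ] (c * f i) ≡ c * ∑< n f
*-distribˡ-∑< zero    c f = sym (ℚP.*-zeroʳ c)
*-distribˡ-∑< (suc n) c f = trans (cong (_+_ (c * f 0)) (*-distribˡ-∑< n c (f ∘ suc)))
                                  (sym (ℚP.*-distribˡ-+ c (f 0) (∑< n (f ∘ suc))))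

neg-distrib-∑< : ∀ n f → ∑[ i < n ] (- f i) ≡ - ∑< n f
neg-distrib-∑< zero    f = refl
neg-distrib-∑< (suc n) f = trans (cong (_+_ (- f 0)) (neg-distrib-∑< n (f ∘ suc)))
                                 (sym (ℚP.neg-distrib-+ (f 0) (∑< n (f ∘ suc))))

∑<-comm : ∀ n m (f : ℕ → ℕ → ℚ) → ∑[ i < n ] ∑[ j < m ] f i j ≡ ∑[ j < m ] ∑[ i < n ] f i j
∑<-comm zero    m f = sym (∑<-zero m)
∑<-comm (suc n) m f = trans (cong (_+_ (∑< m (f 0))) (∑<-comm n m (f ∘ suc)))
                            (sym (∑<-distrib-+ m (f 0) _))

∑<-suc : ∀ n f → ∑< (suc n) f ≡ ∑< n f + f n
∑<-suc zero    f = trans (ℚP.+-identityʳ (f 0)) (sym (ℚP.+-identityˡ (f 0)))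
∑<-suc (suc n) f = trans (cong (_+_ (f 0)) (∑<-suc n (f ∘ suc)))
                         (sym (ℚP.+-assoc (f 0) (∑< n (f ∘ suc)) (f (suc n))))

∑<-vanishing-tail : ∀ {k n} f → k ≤ n → (∀ j → k ≤ j → f j ≡ 0ℚ) → ∑< n f ≡ ∑< k f
∑<-vanishing-tail {k} {n} f k≤n tail≡0 = begin
  ∑< n f               ≡⟨ cong (λ m → ∑< m f) (sym (ℕP.m+[n∸m]≡n k≤n)) ⟩
  ∑< (k ℕ.+ (n ∸ k)) f ≡⟨ extend (n ∸ k) ⟩
  ∑< k f               ∎
  where
  open ≡-Reasoning
  extend : ∀ d → ∑< (k ℕ.+ d) f ≡ ∑< k f
  extend zero    = cong (λ m → ∑< m f) (ℕP.+-identityʳ k)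
  extend (suc d) = begin
    ∑< (k ℕ.+ suc d) f             ≡⟨ cong (λ m → ∑< m f) (ℕP.+-suc k d) ⟩
    ∑< (suc (k ℕ.+ d)) f           ≡⟨ ∑<-suc (k ℕ.+ d) f ⟩
    ∑< (k ℕ.+ d) f + f (k ℕ.+ d)   ≡⟨ cong₂ _+_ (extend d) (tail≡0 (k ℕ.+ d) (ℕP.m≤m+n k d)) ⟩
    ∑< k f + 0ℚ                    ≡⟨ ℚP.+-identityʳ _ ⟩
    ∑< k f                         ∎

sumℚ-++ : ∀ xs ys → sumℚ (xs ++ ys) ≡ sumℚ xs + sumℚ ys
sumℚ-++ []       ys = sym (ℚP.+-identityˡ (sumℚ ys))
sumℚ-++ (x ∷ xs) ys = trans (cong (_+_ x) (sumℚ-++ xs ys)) (sym (ℚP.+-assoc x (sumℚ xs) (sumℚ ys)))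

sumℚ-concatMap : ∀ {A B : Set} (h : B → ℚ) (G : A → List B) xs →
  sumℚ (map h (concatMap G xs)) ≡ sumℚ (map (λ x → sumℚ (map h (G x))) xs)
sumℚ-concatMap h G []       = refl
sumℚ-concatMap h G (x ∷ xs) = begin
  sumℚ (map h (G x ++ concatMap G xs))           ≡⟨ cong sumℚ (map-++ h (G x) (concatMap G xs)) ⟩
  sumℚ (map h (G x) ++ map h (concatMap G xs))   ≡⟨ sumℚ-++ (map h (G x)) _ ⟩
  sumℚ (map h (G x)) + sumℚ (map h (concatMap G xs)) ≡⟨ cong (_+_ (sumℚ (map h (G x)))) (sumℚ-concatMap h G xs) ⟩
  sumℚ (map h (G x)) + sumℚ (map (λ y → sumℚ (map h (G y))) xs) ∎
  where open ≡-Reasoning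

sumℚ-map-∷ : ∀ {A : Set} (h h′ : List A → ℚ) c x xss → (∀ xs → h (x ∷ xs) ≡ c * h′ xs) →
  sumℚ (map h (map (x ∷_) xss)) ≡ c * sumℚ (map h′ xss)
sumℚ-map-∷ h h′ c x []         h≡ch′ = sym (ℚP.*-zeroʳ c)
sumℚ-map-∷ h h′ c x (xs ∷ xss) h≡ch′ = trans (cong₂ _+_ (h≡ch′ xs) (sumℚ-map-∷ h h′ c x xss h≡ch′))
                                             (sym (ℚP.*-distribˡ-+ c (h′ xs) (sumℚ (map h′ xss))))

sgn : ℕ → ℚ
sgn n = (- 1ℚ) ^ℚ n

sgn-+ : ∀ a b → sgn (a ℕ.+ b) ≡ sgn a * sgn b
sgn-+ zero    b = sym (ℚP.*-identityˡ (sgn b))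
sgn-+ (suc a) b = trans (cong (- 1ℚ *_) (sgn-+ a b)) (sym (ℚP.*-assoc (- 1ℚ) (sgn a) (sgn b)))

sgn*sgn : ∀ a → sgn a * sgn a ≡ 1ℚ
sgn*sgn zero    = refl
sgn*sgn (suc a) = trans (*-interchange (- 1ℚ) (sgn a) (- 1ℚ) (sgn a)) (cong (1ℚ *_) (sgn*sgn a))

neg-sgn : ∀ e → - sgn e ≡ sgn (suc e)
neg-sgn e = trans (cong -_ (sym (ℚP.*-identityˡ (sgn e)))) (ℚP.neg-distribˡ-* 1ℚ (sgn e))

sgn-+≡sgn-∸ : ∀ {k m} → k ≤ m → sgn (m ℕ.+ k) ≡ sgn (m ∸ k)
sgn-+≡sgn-∸ {k} {m} k≤m = begin
  sgn (m ℕ.+ k)                   ≡⟨ cong (λ x → sgn (x ℕ.+ k)) (sym (ℕP.m∸n+n≡m k≤m)) ⟩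
  sgn (m ∸ k ℕ.+ k ℕ.+ k)         ≡⟨ cong sgn (ℕP.+-assoc (m ∸ k) k k) ⟩
  sgn (m ∸ k ℕ.+ (k ℕ.+ k))       ≡⟨ sgn-+ (m ∸ k) (k ℕ.+ k) ⟩
  sgn (m ∸ k) * sgn (k ℕ.+ k)     ≡⟨ cong (sgn (m ∸ k) *_) (trans (sgn-+ k k) (sgn*sgn k)) ⟩
  sgn (m ∸ k) * 1ℚ                ≡⟨ ℚP.*-identityʳ (sgn (m ∸ k)) ⟩
  sgn (m ∸ k)                     ∎
  where open ≡-Reasoning

compSum : (ℕ → ℚ) → ℕ → ℕ → ℚ
compSum w k m = sumℚ (map (λ es → prodℚ (map w es)) (comps k m))

compSum-suc : ∀ w k m → compSum w (suc k) m ≡ ∑[ i < m ] (w (suc i) * compSum w k (m ∸ suc i))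
compSum-suc w k m = begin
  compSum w (suc k) m
    ≡⟨ sumℚ-concatMap weight (λ i → map (suc i ∷_) (comps k (m ∸ suc i))) (upTo m) ⟩
  sumℚ (map (λ i → sumℚ (map weight (map (suc i ∷_) (comps k (m ∸ suc i))))) (upTo m))
    ≡⟨ cong sumℚ (map-cong (λ i → sumℚ-map-∷ weight weight (w (suc i)) (suc i) (comps k (m ∸ suc i)) (λ _ → refl))
                           (upTo m)) ⟩
  sumℚ (map (λ i → w (suc i) * compSum w k (m ∸ suc i)) (upTo m))
    ≡⟨ ∑<-upTo m _ ⟩
  ∑[ i < m ] (w (suc i) * compSum w k (m ∸ suc i)) ∎
  where
  open ≡-Reasoning
  weight : List ℕ → ℚ
  weight es = prodℚ (map w es)

compSum-vanishes : ∀ w {k m} → m < k → compSum w k m ≡ 0ℚ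
compSum-vanishes w {suc k} {zero}  _         = refl
compSum-vanishes w {suc k} {suc m} (s≤s m<k) = begin
  compSum w (suc k) (suc m)                              ≡⟨ compSum-suc w k (suc m) ⟩
  ∑[ i < suc m ] (w (suc i) * compSum w k (m ∸ i))      ≡⟨ ∑<-cong (suc m) vanish ⟩
  ∑[ i < suc m ] 0ℚ                                      ≡⟨ ∑<-zero (suc m) ⟩
  0ℚ                                                     ∎
  where
  open ≡-Reasoning
  vanish : ∀ i → i < suc m → w (suc i) * compSum w k (m ∸ i) ≡ 0ℚ
  vanish i _ = trans (cong (w (suc i) *_) (compSum-vanishes w (ℕP.≤-<-trans (ℕP.m∸n≤m m i) m<k)))
                     (ℚP.*-zeroʳ (w (suc i)))

compSum-sgn : ∀ w v → (∀ e → w e ≡ sgn (suc e) * v e) →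
  ∀ k m → compSum w k m ≡ sgn (m ℕ.+ k) * compSum v k m
compSum-sgn w v w≡sgn*v zero    zero    = refl
compSum-sgn w v w≡sgn*v zero    (suc m) = sym (ℚP.*-zeroʳ (sgn (suc m ℕ.+ 0)))
compSum-sgn w v w≡sgn*v (suc k) m       = begin
  compSum w (suc k) m                                             ≡⟨ compSum-suc w k m ⟩
  ∑[ i < m ] (w (suc i) * compSum w k (m ∸ suc i))               ≡⟨ ∑<-cong m term ⟩
  ∑[ i < m ] (sgn (m ℕ.+ suc k) * (v (suc i) * compSum v k (m ∸ suc i)))
                                                                  ≡⟨ *-distribˡ-∑< m (sgn (m ℕ.+ suc k)) _ ⟩
  sgn (m ℕ.+ suc k) * ∑[ i < m ] (v (suc i) * compSum v k (m ∸ suc i))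
                                                                  ≡⟨ cong (sgn (m ℕ.+ suc k) *_) (sym (compSum-suc v k m)) ⟩
  sgn (m ℕ.+ suc k) * compSum v (suc k) m                         ∎
  where
  open ≡-Reasoning
  exponent : ∀ i → i < m → suc (suc i) ℕ.+ (m ∸ suc i ℕ.+ k) ≡ m ℕ.+ suc k
  exponent i i<m = trans (cong suc (sym (ℕP.+-assoc (suc i) (m ∸ suc i) k)))
                         (trans (cong (λ x → suc (x ℕ.+ k)) (ℕP.m+[n∸m]≡n i<m)) (sym (ℕP.+-suc m k)))
  term : ∀ i → i < m → w (suc i) * compSum w k (m ∸ suc i)
                     ≡ sgn (m ℕ.+ suc k) * (v (suc i) * compSum v k (m ∸ suc i))
  term i i<m = begin
    w (suc i) * compSum w k (m ∸ suc i)
      ≡⟨ cong₂ _*_ (w≡sgn*v (suc i)) (compSum-sgn w v w≡sgn*v k (m ∸ suc i)) ⟩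
    sgn (suc (suc i)) * v (suc i) * (sgn (m ∸ suc i ℕ.+ k) * compSum v k (m ∸ suc i))
      ≡⟨ *-interchange (sgn (suc (suc i))) (v (suc i)) (sgn (m ∸ suc i ℕ.+ k)) _ ⟩
    sgn (suc (suc i)) * sgn (m ∸ suc i ℕ.+ k) * (v (suc i) * compSum v k (m ∸ suc i))
      ≡⟨ cong (_* (v (suc i) * compSum v k (m ∸ suc i)))
              (trans (sym (sgn-+ (suc (suc i)) (m ∸ suc i ℕ.+ k))) (cong sgn (exponent i i<m))) ⟩
    sgn (m ℕ.+ suc k) * (v (suc i) * compSum v k (m ∸ suc i)) ∎

invS-suc-invUpTo : ∀ a n →
  invS a (suc n) ≡ - sumℚ (map (λ k → a (suc k) * invUpTo a n (n ∸ k)) (upTo (suc n)))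
invS-suc-invUpTo a n with suc n ≤? n
... | yes n<n = ⊥-elim (ℕP.<-irrefl refl n<n)
... | no  _   = refl

invUpTo-stable : ∀ a {n m} → m ≤ n → invUpTo a n m ≡ invS a m
invUpTo-stable a {zero}  {zero} z≤n = refl
invUpTo-stable a {suc n} {m}    m≤n with m ≤? n
... | yes m≤n′ = invUpTo-stable a m≤n′
... | no  m≰n′ = trans (sym (invS-suc-invUpTo a n)) (cong (invS a) (ℕP.≤-antisym (ℕP.≰⇒> m≰n′) m≤n))

invS-suc : ∀ a n → invS a (suc n) ≡ - ∑[ k < suc n ] (a (suc k) * invS a (n ∸ k))
invS-suc a n = trans (invS-suc-invUpTo a n) (cong -_ (trans
  (∑<-upTo (suc n) (λ k → a (suc k) * invUpTo a n (n ∸ k)))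
  (∑<-cong (suc n) (λ k _ → cong (a (suc k) *_) (invUpTo-stable a (ℕP.m∸n≤m n k))))))

invS-unique : ∀ a (t : Series) → t 0 ≡ 1ℚ →
  (∀ n → t (suc n) ≡ - ∑[ k < suc n ] (a (suc k) * t (n ∸ k))) → ∀ m → invS a m ≡ t m
invS-unique a t t₀≡1 t-suc m = bounded m ℕP.≤-refl
  where
  bounded : ∀ {n} m → m ≤ n → invS a m ≡ t m
  bounded         zero    _         = sym t₀≡1
  bounded {suc n} (suc m) (s≤s m≤n) = begin
    invS a (suc m)                                  ≡⟨ invS-suc a m ⟩
    - ∑[ k < suc m ] (a (suc k) * invS a (m ∸ k))   ≡⟨ cong -_ (∑<-cong (suc m) λ k _ →
                                                         cong (a (suc k) *_) (bounded (m ∸ k) (ℕP.≤-trans (ℕP.m∸n≤m m k) m≤n))) ⟩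
    - ∑[ k < suc m ] (a (suc k) * t (m ∸ k))        ≡⟨ sym (t-suc m) ⟩
    t (suc m)                                       ∎
    where open ≡-Reasoning

invS≡∑compSum : ∀ a m → invS a m ≡ ∑[ j < suc m ] compSum (λ e → - a e) j m
invS≡∑compSum a = invS-unique a T refl T-suc
  where
  open ≡-Reasoning
  Q : ℕ → ℕ → ℚ
  Q = compSum (λ e → - a e)
  T : Series
  T m = ∑[ j < suc m ] Q j m
  T-extend : ∀ {n m} → m ≤ n → ∑[ j < suc n ] Q j m ≡ T m
  T-extend m≤n = ∑<-vanishing-tail (λ j → Q j _) (s≤s m≤n) (λ j → compSum-vanishes (λ e → - a e))
  T-suc : ∀ n → T (suc n) ≡ - ∑[ k < suc n ] (a (suc k) * T (n ∸ k))
  T-suc n = begin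
    0ℚ + ∑[ j < suc n ] Q (suc j) (suc n)
      ≡⟨ ℚP.+-identityˡ _ ⟩
    ∑[ j < suc n ] Q (suc j) (suc n)
      ≡⟨ ∑<-cong (suc n) (λ j _ → compSum-suc (λ e → - a e) j (suc n)) ⟩
    ∑[ j < suc n ] ∑[ k < suc n ] (- a (suc k) * Q j (n ∸ k))
      ≡⟨ ∑<-comm (suc n) (suc n) (λ j k → - a (suc k) * Q j (n ∸ k)) ⟩
    ∑[ k < suc n ] ∑[ j < suc n ] (- a (suc k) * Q j (n ∸ k))
      ≡⟨ ∑<-cong (suc n) (λ k _ → *-distribˡ-∑< (suc n) (- a (suc k)) (λ j → Q j (n ∸ k))) ⟩
    ∑[ k < suc n ] (- a (suc k) * ∑[ j < suc n ] Q j (n ∸ k))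
      ≡⟨ ∑<-cong (suc n) (λ k _ → cong (- a (suc k) *_) (T-extend (ℕP.m∸n≤m n k))) ⟩
    ∑[ k < suc n ] (- a (suc k) * T (n ∸ k))
      ≡⟨ ∑<-cong (suc n) (λ k _ → sym (ℚP.neg-distribˡ-* (a (suc k)) (T (n ∸ k)))) ⟩
    ∑[ k < suc n ] (- (a (suc k) * T (n ∸ k)))
      ≡⟨ neg-distrib-∑< (suc n) (λ k → a (suc k) * T (n ∸ k)) ⟩
    - ∑[ k < suc n ] (a (suc k) * T (n ∸ k)) ∎

rising-1 : ∀ e → rising 1 e ≡ fact e
rising-1 zero    = refl
rising-1 (suc e) = trans (cong (ℕ._* suc e) (rising-1 e)) (ℕP.*-comm (fact e) (suc e))

rising-*-+ : ∀ x e → rising x e ℕ.* (x ℕ.+ e) ≡ x ℕ.* rising (suc x) e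
rising-*-+ x zero    = trans (ℕP.*-identityˡ (x ℕ.+ 0)) (trans (ℕP.+-identityʳ x) (sym (ℕP.*-identityʳ x)))
rising-*-+ x (suc e) = begin
  rising x e ℕ.* (x ℕ.+ e) ℕ.* (x ℕ.+ suc e)     ≡⟨ cong (ℕ._* (x ℕ.+ suc e)) (rising-*-+ x e) ⟩
  x ℕ.* rising (suc x) e ℕ.* (x ℕ.+ suc e)       ≡⟨ ℕP.*-assoc x (rising (suc x) e) (x ℕ.+ suc e) ⟩
  x ℕ.* (rising (suc x) e ℕ.* (x ℕ.+ suc e))     ≡⟨ cong (λ y → x ℕ.* (rising (suc x) e ℕ.* y)) (ℕP.+-suc x e) ⟩
  x ℕ.* rising (suc x) (suc e)                   ∎
  where open ≡-Reasoning

rising-nonZero : ∀ x e → NonZero (rising (suc x) e)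
rising-nonZero x zero    = _
rising-nonZero x (suc e) = ℕP.m*n≢0 (rising (suc x) e) (suc x ℕ.+ e) {{rising-nonZero x e}}

fact-nonZero : ∀ e → NonZero (fact e)
fact-nonZero zero    = _
fact-nonZero (suc e) = ℕP.m*n≢0 (suc e) (fact e) {{_}} {{fact-nonZero e}}

ratio : ℕ → ℕ → ℚ
ratio N i = ℕ→ℚ N * recipℕ (N ℕ.+ i)

hyp2F1coeff-1-N-sucN : ∀ N e .{{_ : NonZero N}} → hyp2F1coeff 1 N (suc N) e ≡ ratio N e
hyp2F1coeff-1-N-sucN (suc N) e =
  ℕ→ℚ*recipℕ-cross (rising 1 e ℕ.* rising (suc N) e) (rising (suc (suc N)) e ℕ.* fact e) (suc N) (suc N ℕ.+ e)
    {{ℕP.m*n≢0 _ _ {{rising-nonZero (suc N) e}} {{fact-nonZero e}}}} cross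
  where
  open ≡-Reasoning
  cross : rising 1 e ℕ.* rising (suc N) e ℕ.* (suc N ℕ.+ e) ≡ suc N ℕ.* (rising (suc (suc N)) e ℕ.* fact e)
  cross = begin
    rising 1 e ℕ.* rising (suc N) e ℕ.* (suc N ℕ.+ e)   ≡⟨ ℕP.*-assoc (rising 1 e) _ _ ⟩
    rising 1 e ℕ.* (rising (suc N) e ℕ.* (suc N ℕ.+ e)) ≡⟨ cong₂ ℕ._*_ (rising-1 e) (rising-*-+ (suc N) e) ⟩
    fact e ℕ.* (suc N ℕ.* rising (suc (suc N)) e)       ≡⟨ ℕP.*-comm (fact e) _ ⟩
    suc N ℕ.* rising (suc (suc N)) e ℕ.* fact e         ≡⟨ ℕP.*-assoc (suc N) (rising (suc (suc N)) e) (fact e) ⟩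
    suc N ℕ.* (rising (suc (suc N)) e ℕ.* fact e)       ∎

F-coeff : ∀ N e .{{_ : NonZero N}} → F N e ≡ sgn e * ratio N e
F-coeff N e = cong (sgn e *_) (hyp2F1coeff-1-N-sucN N e)

D-suc : ∀ N r e → D N (suc r) e ≡ ∑[ i < suc e ] (ratio N i * D N r (e ∸ i))
D-suc N r e = begin
  D N (suc r) e
    ≡⟨ sumℚ-concatMap (term (suc r)) (λ i → map (i ∷_) (weakComps r (e ∸ i))) (upTo (suc e)) ⟩
  sumℚ (map (λ i → sumℚ (map (term (suc r)) (map (i ∷_) (weakComps r (e ∸ i))))) (upTo (suc e)))
    ≡⟨ cong sumℚ (map-cong (λ i → sumℚ-map-∷ (term (suc r)) (term r) (ratio N i) i (weakComps r (e ∸ i)) (term-∷ i))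
                           (upTo (suc e))) ⟩
  sumℚ (map (λ i → ratio N i * D N r (e ∸ i)) (upTo (suc e)))
    ≡⟨ ∑<-upTo (suc e) (λ i → ratio N i * D N r (e ∸ i)) ⟩
  ∑[ i < suc e ] (ratio N i * D N r (e ∸ i)) ∎
  where
  open ≡-Reasoning
  denominator : List ℕ → ℕ
  denominator is = foldr ℕ._*_ 1 (map (N ℕ.+_) is)
  term : ℕ → List ℕ → ℚ
  term s is = ℕ→ℚ (N ℕ.^ s) * recipℕ (denominator is)
  term-∷ : ∀ i is → term (suc r) (i ∷ is) ≡ ratio N i * term r is
  term-∷ i is = trans (cong₂ _*_ (ℕ→ℚ-homo-* N (N ℕ.^ r)) (recipℕ-homo-* (N ℕ.+ i) (denominator is)))
                      (*-interchange (ℕ→ℚ N) (ℕ→ℚ (N ℕ.^ r)) (recipℕ (N ℕ.+ i)) (recipℕ (denominator is)))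

powS-F : ∀ N r e .{{_ : NonZero N}} → powS (F N) r e ≡ sgn e * D N r e
powS-F N zero    zero    = refl
powS-F N zero    (suc e) = sym (ℚP.*-zeroʳ (sgn (suc e)))
powS-F N (suc r) e       = begin
  powS (F N) (suc r) e                                   ≡⟨ ∑<-upTo (suc e) (λ k → F N k * powS (F N) r (e ∸ k)) ⟩
  ∑[ k < suc e ] (F N k * powS (F N) r (e ∸ k))         ≡⟨ ∑<-cong (suc e) term ⟩
  ∑[ k < suc e ] (sgn e * (ratio N k * D N r (e ∸ k)))  ≡⟨ *-distribˡ-∑< (suc e) (sgn e) (λ k → ratio N k * D N r (e ∸ k)) ⟩
  sgn e * ∑[ k < suc e ] (ratio N k * D N r (e ∸ k))    ≡⟨ cong (sgn e *_) (sym (D-suc N r e)) ⟩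
  sgn e * D N (suc r) e                                  ∎
  where
  open ≡-Reasoning
  term : ∀ k → k < suc e → F N k * powS (F N) r (e ∸ k) ≡ sgn e * (ratio N k * D N r (e ∸ k))
  term k (s≤s k≤e) = begin
    F N k * powS (F N) r (e ∸ k)                     ≡⟨ cong₂ _*_ (F-coeff N k) (powS-F N r (e ∸ k)) ⟩
    sgn k * ratio N k * (sgn (e ∸ k) * D N r (e ∸ k)) ≡⟨ *-interchange (sgn k) (ratio N k) (sgn (e ∸ k)) (D N r (e ∸ k)) ⟩
    sgn k * sgn (e ∸ k) * (ratio N k * D N r (e ∸ k)) ≡⟨ cong (_* (ratio N k * D N r (e ∸ k)))
                                                          (trans (sym (sgn-+ k (e ∸ k))) (cong sgn (ℕP.m+[n∸m]≡n k≤e))) ⟩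
    sgn e * (ratio N k * D N r (e ∸ k))               ∎

proposition3 : (N r n : ℕ) → 1 ≤ N → 1 ≤ r → 1 ≤ n → hcauchy N r n ≡ rhs N r n
proposition3 N r (suc n) 1≤N _ _ = cong (ℕ→ℚ (fact (suc n)) *_) (begin
  invS a (suc n)
    ≡⟨ invS≡∑compSum a (suc n) ⟩
  ∑[ j < suc (suc n) ] compSum (λ e → - a e) j (suc n)
    ≡⟨⟩
  0ℚ + ∑[ j < suc n ] compSum (λ e → - a e) (suc j) (suc n)
    ≡⟨ ℚP.+-identityˡ _ ⟩
  ∑[ j < suc n ] compSum (λ e → - a e) (suc j) (suc n)
    ≡⟨ ∑<-cong (suc n) (λ j j<n → trans (compSum-sgn (λ e → - a e) (D N r) -a≡sgn*D (suc j) (suc n))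
                                         (cong (_* compSum (D N r) (suc j) (suc n)) (sgn-+≡sgn-∸ j<n))) ⟩
  ∑[ j < suc n ] (sgn (suc n ∸ suc j) * compSum (D N r) (suc j) (suc n))
    ≡⟨ sym (∑<-upTo (suc n) (λ j → sgn (suc n ∸ suc j) * compSum (D N r) (suc j) (suc n))) ⟩
  sumℚ (map (λ j → sgn (suc n ∸ suc j) * compSum (D N r) (suc j) (suc n)) (upTo (suc n))) ∎)
  where
  open ≡-Reasoning
  instance
    N-nonZero : NonZero N
    N-nonZero = ℕ.>-nonZero 1≤N
  a : Series
  a = powS (F N) r
  -a≡sgn*D : ∀ e → - a e ≡ sgn (suc e) * D N r e
  -a≡sgn*D e = trans (cong -_ (powS-F N r e))
                     (trans (ℚP.neg-distribˡ-* (sgn e) (D N r e)) (cong (_* D N r e) (neg-sgn e)))
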